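{- Let $\epsilon=\epsilon_1\cdots\epsilon_n\in\{1,-1\}^n$ with $\epsilon_1=1$ and $\epsilon_n=-1$, let $j$ be the smallest index with $\epsilon_j=-1$, and let $\epsilon'=\epsilon_{j+1}\cdots\epsilon_n$ (possibly empty). For $T\subseteq\{1,\dots,j-1\}$ put $d(T)=\#\{k\in\{1,\dots,j-1\}\setminus T: k>\min T\}$ if $T\neq\emptyset$ and $d(\emptyset)=0$, and let $\epsilon(T)$ be the concatenation of $j-1-d(T)$ entries equal to $1$ followed by $\epsilon'$. Then $$\mathcal{W}(\epsilon)=\sum_{T\subseteq\{1,\dots,j-1\}} q^{|T|}\,\mathcal{W}(\epsilon(T)).$$
   Context: A network on $m$ points is a set $E$ of pairs $(i,k)$ with $1\le i<k\le m$ (directed edges; $i$ is then a source and $k$ a sink) such that there are no $(i,k),(k,l)\in E$, and satisfying (B1): if $(i,k),(j,l)\in E$ with $i<j<k<l$ then $(j,k)\in E$. For a sequence $\delta\in\{1,-1\}^m$ beginning with $1$, $\mathcal{N}(m;\delta)$ is the set of such networks on $m$ points in which every source $i$ has $\delta_i=1$ and every sink $k$ has $\delta_k=-1$. The rank of a network is its number of edges. The Whitney numbers of the second kind are $W_r(\delta)=\#\{N\in\mathcal{N}(m;\delta):N\text{ has }r\text{ edges}\}$, and $\mathcal{W}(\delta)=\sum_{r\ge0}q^rW_r(\delta)$ (a polynomial in $q$). -}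

module Defs where

open import Data.Nat using (ℕ; zero; suc; _∸_; _⊓_; _≡ᵇ_; _<ᵇ_)
open import Data.Bool using (Bool; true; false; _∧_; _∨_; not; T?)
open import Data.List using (List; []; _∷_; _++_; map; filter; length; replicate; drop; foldr; upTo; cartesianProduct)
open import Data.Bool.ListAction using (any; all)
open import Data.Maybe using (Maybe; just; nothing)
open import Data.Product using (_×_; _,_; proj₁; proj₂)

-- Signs: p1 stands for the entry 1, m1 for the entry -1.
data Sgn : Set where
  p1 m1 : Sgn

-- 1-based lookup: at xs i = just (i-th entry) if 1 ≤ i ≤ length xs.
at : {A : Set} → List A → ℕ → Maybe A
at []       _             = nothing
at (x ∷ xs) zero          = nothing
at (x ∷ xs) (suc zero)    = just x
at (x ∷ xs) (suc (suc i)) = at xs (suc i)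

range1 : ℕ → List ℕ
range1 m = map suc (upTo m)

subsetsOf : {A : Set} → List A → List (List A)
subsetsOf []       = [] ∷ []
subsetsOf (x ∷ xs) = subsetsOf xs ++ map (x ∷_) (subsetsOf xs)

Edge : Set
Edge = ℕ × ℕ

allPairs : ℕ → List Edge
allPairs m = filter (λ e → T? (proj₁ e <ᵇ proj₂ e)) (cartesianProduct (range1 m) (range1 m))

eqEdge : Edge → Edge → Bool
eqEdge (i , k) (j , l) = (i ≡ᵇ j) ∧ (k ≡ᵇ l)

memEdge : Edge → List Edge → Bool
memEdge e E = any (eqEdge e) E

noPath : List Edge → Bool
noPath E = all (λ e₁ → all (λ e₂ → not (proj₂ e₁ ≡ᵇ proj₁ e₂)) E) E

condB1 : List Edge → Bool
condB1 E = all (λ e₁ → all (λ e₂ →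
    not ((proj₁ e₁ <ᵇ proj₁ e₂) ∧ (proj₁ e₂ <ᵇ proj₂ e₁) ∧ (proj₂ e₁ <ᵇ proj₂ e₂))
    ∨ memEdge (proj₁ e₂ , proj₂ e₁) E) E) E

isP : Maybe Sgn → Bool
isP (just p1) = true
isP _         = false

isM : Maybe Sgn → Bool
isM (just m1) = true
isM _         = false

signsOK : List Sgn → List Edge → Bool
signsOK δ E = all (λ e → isP (at δ (proj₁ e)) ∧ isM (at δ (proj₂ e))) E

-- E ∈ 𝒩(m;δ) (E is assumed to be a set of pairs (i,k), 1 ≤ i < k ≤ m)
isNetwork : List Sgn → List Edge → Bool
isNetwork δ E = noPath E ∧ condB1 E ∧ signsOK δ E

-- Whitney numbers W_r(δ): number of networks in 𝒩(length δ; δ) with r edges.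
-- Each edge set is enumerated exactly once as a sublist of allPairs m.
W : ℕ → List Sgn → ℕ
W r δ = length (filter (λ E → T? (isNetwork δ E ∧ (length E ≡ᵇ r)))
                       (subsetsOf (allPairs (length δ))))

-- Polynomials in q with ℕ coefficients, as coefficient sequences.

Poly : Set
Poly = ℕ → ℕ

𝒲 : List Sgn → Poly
𝒲 δ r = W r δ

qPow* : ℕ → Poly → Poly
qPow* a f r with a Data.Nat.≤ᵇ r
... | true  = f (r ∸ a)
... | false = 0

_+P_ : Poly → Poly → Poly
(f +P g) r = f r Data.Nat.+ g r

sumP : List Poly → Poly
sumP = foldr _+P_ (λ _ → 0)

memℕ : ℕ → List ℕ → Bool
memℕ k T = any (k ≡ᵇ_) T

dT : ℕ → List ℕ → ℕ
dT j []       = 0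
dT j (t ∷ ts) = length (filter (λ k → T? (not (memℕ k (t ∷ ts)) ∧ (foldr _⊓_ t ts <ᵇ k)))
                               (range1 (j ∸ 1)))

εT : List Sgn → ℕ → List ℕ → List Sgn
εT ε j T = replicate (j ∸ 1 ∸ dT j T) p1 ++ drop j ε

-- Write ε = 1^ℓ (−1) ε′, so that j = ℓ + 1. Positions 1, …, ℓ are positive and j is negative, so a
-- network is I × {j} together with a network R with no edge into j, for some I ⊆ {1, …, ℓ}. For
-- fixed I the union is a network iff R avoids j and every position of {1, …, ℓ} ∖ I above min I:
-- such a position k is positive, so not a sink, and an edge (k, v) ∈ R would by (B1) with
-- (min I, j) force k ∈ I; conversely these are exactly the instances of (B1) involving the new
-- edges. Networks avoiding a set X of positions correspond, by the order-preserving relabelling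
-- of the remaining positions, to networks on ε with X deleted, and deleting j and those d(I)
-- positions leaves ε(I). The |I| edges into j account for the factor q^|I|.

module Submission where

open import Defs
open import Data.Bool using (Bool; true; false; _∧_; _∨_; not; T; T?; if_then_else_)
open import Data.Bool.ListAction using (all; and)
open import Data.Bool.Properties using (T-∧; T-≡; ∧-assoc; ∧-zeroʳ)
open import Data.Empty using (⊥-elim)
open import Data.List using (List; []; _∷_; _++_; map; filter; length; foldr; replicate; drop; reverse; head; last)
open import Data.List.Membership.Propositional using (_∈_; _∉_)
open import Data.List.Membership.Propositional.Properties
  using (∈-++⁻; ∈-++⁺ˡ; ∈-++⁺ʳ; ∈-map⁺; ∈-map⁻; ∈-filter⁺; ∈-filter⁻; ∈-upTo⁺; ∈-upTo⁻;
         ∈-cartesianProduct⁺; ∈-cartesianProduct⁻; foldr-selective)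
open import Data.List.Membership.Propositional.Properties.WithK using (unique∧set⇒bag)
open import Data.List.Properties
  using (map-++; map-∘; map-cong; map-cong-local; length-map; length-++; length-++-≤ˡ; length-reverse; unfold-reverse)
open import Data.List.Relation.Binary.BagAndSetEquality using (∼bag⇒↭)
open import Data.List.Relation.Binary.Disjoint.Propositional using (Disjoint)
open import Data.List.Relation.Binary.Permutation.Propositional using (_↭_; refl; prep; swap; trans; ↭-sym)
open import Data.List.Relation.Binary.Permutation.Propositional.Properties using (∈-resp-↭; ↭-length)
open import Data.List.Relation.Binary.Subset.Propositional using (_⊆_)
open import Data.List.Relation.Unary.All as All using (All; []; _∷_)
import Data.List.Relation.Unary.All.Properties as All
open import Data.List.Relation.Unary.All.Properties using (all⁺; all⁻; all-anti-mono)
open import Data.List.Relation.Unary.AllPairs using (AllPairs; []; _∷_)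
import Data.List.Relation.Unary.AllPairs.Properties as AllPairs
import Data.List.Relation.Unary.Any as Any
open import Data.List.Relation.Unary.Any using (here; there)
import Data.List.Relation.Unary.Any.Properties as Any
open import Data.List.Relation.Unary.Any.Properties using (any⁺; any⁻)
open import Data.List.Relation.Unary.Unique.Propositional using (Unique)
import Data.List.Relation.Unary.Unique.Propositional.Properties as Unique
open import Data.Maybe using (just; nothing)
open import Data.Nat using (ℕ; zero; suc; pred; _+_; _∸_; _⊓_; _≤_; _<_; _>_; z≤n; s≤s; _≡ᵇ_; _<ᵇ_; _≤ᵇ_; _≟_; _≤?_)
open import Data.Nat.ListAction using (sum)
open import Data.Nat.ListAction.Properties using (sum-++)
open import Data.Nat.Properties
  using (+-identityʳ; +-commutativeSemigroup; suc-injective; ≤-refl; ≤-reflexive; ≤-trans; <⇒≤; <-cmp;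
         <-irrefl; <-asym; ≤-pred; n≤1+n;
         ≰⇒>; <⇒≢; ≤-<-trans; <-≤-trans; ≤∧≢⇒<; pred-mono-≤; ∸-+-assoc; ∸-monoˡ-≤; m+[n∸m]≡n;
         ⊓-sel; m⊓n≤m; m⊓n≤n; ≡ᵇ⇒≡; ≡⇒≡ᵇ; <ᵇ⇒<; <⇒<ᵇ; ≤ᵇ⇒≤; ≤⇒≤ᵇ)
open import Algebra.Properties.CommutativeSemigroup +-commutativeSemigroup using (interchange)
open import Data.List.Membership.DecPropositional _≟_ using (_∈?_)
open import Data.Product using (_×_; _,_; proj₁; proj₂; uncurry)
open import Data.Sum using (inj₁; inj₂)
open import Data.Unit using (tt)
open import Function using (_∘_; flip; mk⇔; Equivalence)
open import Relation.Binary using (_Preserves_⟶_; tri<; tri≈; tri>)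
open import Relation.Binary.PropositionalEquality
  using (_≡_; _≢_; refl; sym; cong; cong₂; subst; ≢-sym; module ≡-Reasoning)
  renaming (trans to ≡-trans)
open import Relation.Nullary using (¬_; yes; no)

variable
  A B : Set

T-not⁻ : ∀ {b} → T (not b) → ¬ T b
T-not⁻ {false} _ ()

T-not⁺ : ∀ {b} → ¬ T b → T (not b)
T-not⁺ {true}  ¬b = ¬b tt
T-not⁺ {false} _  = tt

¬T⇒≡false : ∀ {b} → ¬ T b → b ≡ false
¬T⇒≡false {true}  ¬b = ⊥-elim (¬b tt)
¬T⇒≡false {false} _  = refl

T-∧⁻ : ∀ a b → T (a ∧ b) → T a × T b
T-∧⁻ a b = Equivalence.to (T-∧ {a} {b})

T-∧⁺ : ∀ a b → T a → T b → T (a ∧ b)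
T-∧⁺ a b ta tb = Equivalence.from (T-∧ {a} {b}) (ta , tb)

T⇔T⇒≡ : ∀ {a b} → (T a → T b) → (T b → T a) → a ≡ b
T⇔T⇒≡ {true}  {true}  _ _ = refl
T⇔T⇒≡ {true}  {false} f _ = ⊥-elim (f tt)
T⇔T⇒≡ {false} {true}  _ g = ⊥-elim (g tt)
T⇔T⇒≡ {false} {false} _ _ = refl

T-not-≡ᵇ⇒≢ : ∀ {m n} → T (not (m ≡ᵇ n)) → m ≢ n
T-not-≡ᵇ⇒≢ {m} {n} t m≡n = T-not⁻ t (≡⇒≡ᵇ m n m≡n)

≢⇒T-not-≡ᵇ : ∀ {m n} → m ≢ n → T (not (m ≡ᵇ n))
≢⇒T-not-≡ᵇ {m} {n} m≢n = T-not⁺ (m≢n ∘ ≡ᵇ⇒≡ m n)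

+-≡ᵇ-cancelˡ : ∀ k {a b} → (k + a ≡ᵇ k + b) ≡ (a ≡ᵇ b)
+-≡ᵇ-cancelˡ zero    = refl
+-≡ᵇ-cancelˡ (suc k) = +-≡ᵇ-cancelˡ k

T-implies³⁻ : ∀ {a b c d} → T (not (a ∧ b ∧ c) ∨ d) → T a → T b → T c → T d
T-implies³⁻ {true} {true} {true} t _ _ _ = t

T-implies³⁺ : ∀ {a b c d} → (T a → T b → T c → T d) → T (not (a ∧ b ∧ c) ∨ d)
T-implies³⁺ {true}  {true}  {true}  f = f tt tt tt
T-implies³⁺ {true}  {true}  {false} _ = tt
T-implies³⁺ {true}  {false}         _ = tt
T-implies³⁺ {false}                 _ = tt

lookup² : (p : A → A → Bool) (E : List A) → T (all (λ e → all (p e) E) E) →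
          ∀ {e e′} → e ∈ E → e′ ∈ E → T (p e e′)
lookup² p E t e∈ e′∈ = All.lookup (all⁺ _ E (All.lookup (all⁺ _ E t) e∈)) e′∈

tabulate² : (p : A → A → Bool) (E : List A) →
            (∀ {e e′} → e ∈ E → e′ ∈ E → T (p e e′)) → T (all (λ e → all (p e) E) E)
tabulate² p E f = all⁻ _ (All.tabulate (λ e∈ → all⁻ _ (All.tabulate (f e∈))))

-- Counting sublists

count : (A → Bool) → List A → ℕ
count p []       = 0
count p (x ∷ xs) = if p x then suc (count p xs) else count p xs

length-filter-T? : (p : A → Bool) (xs : List A) → length (filter (T? ∘ p) xs) ≡ count p xs
length-filter-T? p []       = refl
length-filter-T? p (x ∷ xs) with p x
... | true  = cong suc (length-filter-T? p xs)
... | false = length-filter-T? p xs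

count-++ : (p : A → Bool) (xs ys : List A) → count p (xs ++ ys) ≡ count p xs + count p ys
count-++ p []       ys = refl
count-++ p (x ∷ xs) ys with p x
... | true  = cong suc (count-++ p xs ys)
... | false = count-++ p xs ys

count-map : (p : B → Bool) (f : A → B) (xs : List A) → count p (map f xs) ≡ count (p ∘ f) xs
count-map p f []       = refl
count-map p f (x ∷ xs) with p (f x)
... | true  = cong suc (count-map p f xs)
... | false = count-map p f xs

count-cong : (p q : A → Bool) (xs : List A) → (∀ {x} → x ∈ xs → p x ≡ q x) → count p xs ≡ count q xs
count-cong p q []       _   = refl
count-cong p q (x ∷ xs) p≗q with p x | q x | p≗q (here refl)
... | true  | .true  | refl = cong suc (count-cong p q xs (p≗q ∘ there))
... | false | .false | refl = count-cong p q xs (p≗q ∘ there)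

count-none : (p : A → Bool) (xs : List A) → (∀ {x} → x ∈ xs → p x ≡ false) → count p xs ≡ 0
count-none p []       _    = refl
count-none p (x ∷ xs) none with p x | none (here refl)
... | false | refl = count-none p xs (none ∘ there)

countSubsets : (List A → Bool) → List A → ℕ
countSubsets P L = count P (subsetsOf L)

countSubsets-∷ : (P : List A → Bool) (x : A) (L : List A) →
                 countSubsets P (x ∷ L) ≡ countSubsets P L + countSubsets (P ∘ (x ∷_)) L
countSubsets-∷ P x L =
  ≡-trans (count-++ P (subsetsOf L) _) (cong (countSubsets P L +_) (count-map P (x ∷_) (subsetsOf L)))

subsetsOf-⊆ : (L : List A) {S : List A} → S ∈ subsetsOf L → S ⊆ L
subsetsOf-⊆ []      (here refl) ()
subsetsOf-⊆ (y ∷ L) S∈ x∈S with ∈-++⁻ (subsetsOf L) S∈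
... | inj₁ S∈L = there (subsetsOf-⊆ L S∈L x∈S)
... | inj₂ S∈yL with ∈-map⁻ (y ∷_) S∈yL | x∈S
...   | S′ , S′∈ , refl | here refl  = here refl
...   | S′ , S′∈ , refl | there x∈S′ = there (subsetsOf-⊆ L S′∈ x∈S′)

subsetsOf-map : (f : A → B) (L : List A) → subsetsOf (map f L) ≡ map (map f) (subsetsOf L)
subsetsOf-map f []      = refl
subsetsOf-map f (x ∷ L) = begin
  subsetsOf (map f L) ++ map (f x ∷_) (subsetsOf (map f L))
    ≡⟨ cong (λ Ss → Ss ++ map (f x ∷_) Ss) (subsetsOf-map f L) ⟩
  map (map f) Ss ++ map (f x ∷_) (map (map f) Ss)
    ≡⟨ cong (map (map f) Ss ++_) (≡-trans (sym (map-∘ Ss)) (map-∘ Ss)) ⟩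
  map (map f) Ss ++ map (map f) (map (x ∷_) Ss)
    ≡⟨ sym (map-++ (map f) Ss _) ⟩
  map (map f) (Ss ++ map (x ∷_) Ss) ∎
  where
  open ≡-Reasoning
  Ss = subsetsOf L

countSubsets-map : (P : List B → Bool) (f : A → B) (L : List A) →
                   countSubsets P (map f L) ≡ countSubsets (P ∘ map f) L
countSubsets-map P f L = ≡-trans (cong (count P) (subsetsOf-map f L)) (count-map P (map f) (subsetsOf L))

countSubsets-++ : (P : List A → Bool) (Xs Ys : List A) →
  countSubsets P (Xs ++ Ys) ≡ sum (map (λ S → countSubsets (P ∘ (S ++_)) Ys) (subsetsOf Xs))
countSubsets-++ P []       Ys = sym (+-identityʳ _)
countSubsets-++ {A = A} P (x ∷ Xs) Ys = begin
  countSubsets P (x ∷ Xs ++ Ys)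
    ≡⟨ countSubsets-∷ P x (Xs ++ Ys) ⟩
  countSubsets P (Xs ++ Ys) + countSubsets (P ∘ (x ∷_)) (Xs ++ Ys)
    ≡⟨ cong₂ _+_ (countSubsets-++ P Xs Ys) (countSubsets-++ (P ∘ (x ∷_)) Xs Ys) ⟩
  sum (map (split P) Ss) + sum (map (split P ∘ (x ∷_)) Ss)
    ≡⟨ cong (λ Ts → sum (map (split P) Ss) + sum Ts) (map-∘ Ss) ⟩
  sum (map (split P) Ss) + sum (map (split P) (map (x ∷_) Ss))
    ≡⟨ sym (sum-++ (map (split P) Ss) _) ⟩
  sum (map (split P) Ss ++ map (split P) (map (x ∷_) Ss))
    ≡⟨ cong sum (sym (map-++ (split P) Ss _)) ⟩
  sum (map (split P) (Ss ++ map (x ∷_) Ss)) ∎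
  where
  open ≡-Reasoning
  Ss = subsetsOf Xs
  split : (List A → Bool) → List A → ℕ
  split Q S = countSubsets (Q ∘ (S ++_)) Ys

countSubsets-filter : (g : A → Bool) (P : List A → Bool) (L : List A) →
  (∀ R {y} → y ∈ R → T (P R) → T (g y)) →
  countSubsets P L ≡ countSubsets P (filter (T? ∘ g) L)
countSubsets-filter g P []      _         = refl
countSubsets-filter g P (x ∷ L) supported with g x in gx
... | true = begin
  countSubsets P (x ∷ L)
    ≡⟨ countSubsets-∷ P x L ⟩
  countSubsets P L + countSubsets (P ∘ (x ∷_)) L
    ≡⟨ cong₂ _+_ (countSubsets-filter g P L supported)
                 (countSubsets-filter g (P ∘ (x ∷_)) L (λ R → supported (x ∷ R) ∘ there)) ⟩
  countSubsets P L′ + countSubsets (P ∘ (x ∷_)) L′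
    ≡⟨ sym (countSubsets-∷ P x L′) ⟩
  countSubsets P (x ∷ L′) ∎
  where
  open ≡-Reasoning
  L′ = filter (T? ∘ g) L
... | false = begin
  countSubsets P (x ∷ L)
    ≡⟨ countSubsets-∷ P x L ⟩
  countSubsets P L + countSubsets (P ∘ (x ∷_)) L
    ≡⟨ cong (countSubsets P L +_) (count-none _ (subsetsOf L) (λ {R} _ → ¬T⇒≡false (x∉ R))) ⟩
  countSubsets P L + 0
    ≡⟨ +-identityʳ _ ⟩
  countSubsets P L
    ≡⟨ countSubsets-filter g P L supported ⟩
  countSubsets P (filter (T? ∘ g) L) ∎
  where
  open ≡-Reasoning
  x∉ : ∀ R → ¬ T (P (x ∷ R))
  x∉ R t = subst T gx (supported (x ∷ R) (here refl) t)

PermutationInvariant : (List A → Bool) → Set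
PermutationInvariant P = ∀ {S S′} → S ↭ S′ → P S ≡ P S′

countSubsets-↭ : (P : List A → Bool) → PermutationInvariant P →
                 {xs ys : List A} → xs ↭ ys → countSubsets P xs ≡ countSubsets P ys
countSubsets-↭ P inv refl        = refl
countSubsets-↭ P inv (trans p q) = ≡-trans (countSubsets-↭ P inv p) (countSubsets-↭ P inv q)
countSubsets-↭ P inv {x ∷ xs} {x ∷ ys} (prep x p) = begin
  countSubsets P (x ∷ xs)
    ≡⟨ countSubsets-∷ P x xs ⟩
  countSubsets P xs + countSubsets (P ∘ (x ∷_)) xs
    ≡⟨ cong₂ _+_ (countSubsets-↭ P inv p) (countSubsets-↭ (P ∘ (x ∷_)) (inv ∘ prep x) p) ⟩
  countSubsets P ys + countSubsets (P ∘ (x ∷_)) ys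
    ≡⟨ sym (countSubsets-∷ P x ys) ⟩
  countSubsets P (x ∷ ys) ∎
  where open ≡-Reasoning
countSubsets-↭ P inv {x ∷ y ∷ xs} {y ∷ x ∷ ys} (swap x y p) = begin
  countSubsets P (x ∷ y ∷ xs)
    ≡⟨ expand x y xs ⟩
  (# P xs + # (P ∘ (y ∷_)) xs) + (# (P ∘ (x ∷_)) xs + # (P ∘ (x ∷_) ∘ (y ∷_)) xs)
    ≡⟨ cong₂ _+_ (cong₂ _+_ (countSubsets-↭ P inv p) (countSubsets-↭ _ (inv ∘ prep y) p))
                 (cong₂ _+_ (countSubsets-↭ _ (inv ∘ prep x) p)
                            (≡-trans (countSubsets-↭ _ (inv ∘ prep x ∘ prep y) p)
                                     (count-cong _ _ (subsetsOf ys) (λ _ → inv (swap x y refl))))) ⟩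
  (# P ys + # (P ∘ (y ∷_)) ys) + (# (P ∘ (x ∷_)) ys + # (P ∘ (y ∷_) ∘ (x ∷_)) ys)
    ≡⟨ interchange (# P ys) (# (P ∘ (y ∷_)) ys) (# (P ∘ (x ∷_)) ys) _ ⟩
  (# P ys + # (P ∘ (x ∷_)) ys) + (# (P ∘ (y ∷_)) ys + # (P ∘ (y ∷_) ∘ (x ∷_)) ys)
    ≡⟨ sym (expand y x ys) ⟩
  countSubsets P (y ∷ x ∷ ys) ∎
  where
  open ≡-Reasoning
  # = countSubsets
  expand : ∀ a b L → # P (a ∷ b ∷ L) ≡ (# P L + # (P ∘ (b ∷_)) L) + (# (P ∘ (a ∷_)) L + # (P ∘ (a ∷_) ∘ (b ∷_)) L)
  expand a b L =
    ≡-trans (countSubsets-∷ P a (b ∷ L)) (cong₂ _+_ (countSubsets-∷ P b L) (countSubsets-∷ (P ∘ (a ∷_)) b L))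

↭-fromUnique : {xs ys : List A} → Unique xs → Unique ys → xs ⊆ ys → ys ⊆ xs → xs ↭ ys
↭-fromUnique xs! ys! xs⊆ys ys⊆xs = ∼bag⇒↭ (unique∧set⇒bag xs! ys! (mk⇔ xs⊆ys ys⊆xs))

all-↭ : (p : A → Bool) → PermutationInvariant (all p)
all-↭ p σ = T⇔T⇒≡ (all-anti-mono p (∈-resp-↭ (↭-sym σ))) (all-anti-mono p (∈-resp-↭ σ))

all-map : (p : B → Bool) (f : A → B) (xs : List A) → all p (map f xs) ≡ all (p ∘ f) xs
all-map p f xs = cong and (sym (map-∘ xs))

∈-range1⁻ : ∀ {m k} → k ∈ range1 m → 1 ≤ k × k ≤ m
∈-range1⁻ k∈ with ∈-map⁻ suc k∈
... | i , i∈ , refl = s≤s z≤n , ∈-upTo⁻ i∈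

∈-range1⁺ : ∀ {m k} → 1 ≤ k → k ≤ m → k ∈ range1 m
∈-range1⁺ {k = suc k} _ k≤m = ∈-map⁺ suc (∈-upTo⁺ k≤m)

range1-Unique : ∀ m → Unique (range1 m)
range1-Unique m = Unique.map⁺ suc-injective (Unique.upTo⁺ m)

src snk : Edge → ℕ
src = proj₁
snk = proj₂

∈-allPairs⁻ : ∀ m {a b} → (a , b) ∈ allPairs m → 1 ≤ a × a < b × b ≤ m
∈-allPairs⁻ m ab∈ with ∈-filter⁻ (λ e → T? (src e <ᵇ snk e)) ab∈
... | ab∈² , a<ᵇb with ∈-cartesianProduct⁻ (range1 m) (range1 m) ab∈²
... | a∈ , b∈ = proj₁ (∈-range1⁻ a∈) , <ᵇ⇒< _ _ a<ᵇb , proj₂ (∈-range1⁻ b∈)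

∈-allPairs⁺ : ∀ m {a b} → 1 ≤ a → a < b → b ≤ m → (a , b) ∈ allPairs m
∈-allPairs⁺ m 1≤a a<b b≤m = ∈-filter⁺ (λ e → T? (src e <ᵇ snk e))
  (∈-cartesianProduct⁺ (∈-range1⁺ 1≤a (≤-trans (<⇒≤ a<b) b≤m)) (∈-range1⁺ (≤-trans 1≤a (<⇒≤ a<b)) b≤m))
  (<⇒<ᵇ a<b)

allPairs-Unique : ∀ m → Unique (allPairs m)
allPairs-Unique m =
  Unique.filter⁺ (λ e → T? (src e <ᵇ snk e)) (Unique.cartesianProduct⁺ (range1-Unique m) (range1-Unique m))

at-zero : ∀ (δ : List A) → at δ 0 ≡ nothing
at-zero []      = refl
at-zero (_ ∷ _) = refl

at-positive : ∀ (δ : List A) {i s} → at δ i ≡ just s → 1 ≤ i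
at-positive (y ∷ ys) {i = suc i} _ = s≤s z≤n

at-length : ∀ (δ : List A) {i s} → at δ i ≡ just s → i ≤ length δ
at-length (y ∷ ys) {i = suc zero}    _  = s≤s z≤n
at-length (y ∷ ys) {i = suc (suc i)} eq = s≤s (at-length ys eq)

signs-distinct : ∀ δ {a b} → at δ a ≡ just p1 → at δ b ≡ just m1 → a ≢ b
signs-distinct δ a+ b- refl with ≡-trans (sym a+) b-
... | ()

-- The no-path condition is omitted: it follows from the signs (see `pathFree`).
record Network (δ : List Sgn) (E : List Edge) : Set where
  field
    closedB1       : ∀ {e e′} → e ∈ E → e′ ∈ E → src e < src e′ → src e′ < snk e → snk e < snk e′ →
                     (src e′ , snk e) ∈ E
    sourcePositive : ∀ {e} → e ∈ E → at δ (src e) ≡ just p1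
    sinkNegative   : ∀ {e} → e ∈ E → at δ (snk e) ≡ just m1

open Network

T-isP⁻ : ∀ {s} → T (isP s) → s ≡ just p1
T-isP⁻ {just p1} _ = refl

T-isM⁻ : ∀ {s} → T (isM s) → s ≡ just m1
T-isM⁻ {just m1} _ = refl

T-eqEdge⁻ : ∀ e e′ → T (eqEdge e e′) → e ≡ e′
T-eqEdge⁻ (i , k) (j , l) t =
  let i≡ᵇj , k≡ᵇl = T-∧⁻ (i ≡ᵇ j) (k ≡ᵇ l) t in cong₂ _,_ (≡ᵇ⇒≡ i j i≡ᵇj) (≡ᵇ⇒≡ k l k≡ᵇl)

T-eqEdge-refl : ∀ e → T (eqEdge e e)
T-eqEdge-refl (i , k) = T-∧⁺ (i ≡ᵇ i) (k ≡ᵇ k) (≡⇒≡ᵇ i i refl) (≡⇒≡ᵇ k k refl)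

T-memEdge⁻ : ∀ e E → T (memEdge e E) → e ∈ E
T-memEdge⁻ e E t = Any.map (T-eqEdge⁻ e _) (any⁻ (eqEdge e) E t)

T-memEdge⁺ : ∀ {e E} → e ∈ E → T (memEdge e E)
T-memEdge⁺ {e} e∈ = any⁺ (eqEdge e) (Any.map (λ { refl → T-eqEdge-refl e }) e∈)

isNetwork⇒Network : ∀ δ E → T (isNetwork δ E) → Network δ E
isNetwork⇒Network δ E t = record
  { closedB1       = λ e∈ e′∈ a<b b<c c<d → T-memEdge⁻ _ E
      (T-implies³⁻ (lookup² _ E tB1 e∈ e′∈) (<⇒<ᵇ a<b) (<⇒<ᵇ b<c) (<⇒<ᵇ c<d))
  ; sourcePositive = λ e∈ → T-isP⁻ (proj₁ (signs e∈))
  ; sinkNegative   = λ e∈ → T-isM⁻ (proj₂ (signs e∈))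
  }
  where
  tB1,tSg : T (condB1 E) × T (signsOK δ E)
  tB1,tSg = T-∧⁻ (condB1 E) (signsOK δ E) (proj₂ (T-∧⁻ (noPath E) _ t))
  tB1 = proj₁ tB1,tSg
  signs : ∀ {e} → e ∈ E → T (isP (at δ (src e))) × T (isM (at δ (snk e)))
  signs {e} e∈ = T-∧⁻ (isP (at δ (src e))) (isM (at δ (snk e)))
    (All.lookup (all⁺ (λ e → isP (at δ (src e)) ∧ isM (at δ (snk e))) E (proj₂ tB1,tSg)) e∈)

pathFree : ∀ {δ E} → Network δ E → ∀ {e e′} → e ∈ E → e′ ∈ E → snk e ≢ src e′
pathFree {δ} N e∈ e′∈ eq = signs-distinct δ (sourcePositive N e′∈) (sinkNegative N e∈) (sym eq)

Network⇒isNetwork : ∀ δ E → Network δ E → T (isNetwork δ E)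
Network⇒isNetwork δ E N = T-∧⁺ (noPath E) _ noPath-ok (T-∧⁺ (condB1 E) (signsOK δ E) condB1-ok signsOK-ok)
  where
  noPath-ok : T (noPath E)
  noPath-ok = tabulate² _ E (λ e∈ e′∈ → ≢⇒T-not-≡ᵇ (pathFree N e∈ e′∈))
  condB1-ok : T (condB1 E)
  condB1-ok = tabulate² _ E (λ e∈ e′∈ → T-implies³⁺ (λ a<b b<c c<d →
                T-memEdge⁺ (closedB1 N e∈ e′∈ (<ᵇ⇒< _ _ a<b) (<ᵇ⇒< _ _ b<c) (<ᵇ⇒< _ _ c<d))))
  signsOK-ok : T (signsOK δ E)
  signsOK-ok = all⁻ _ (All.tabulate (λ {e} e∈ → T-∧⁺ (isP (at δ (src e))) (isM (at δ (snk e)))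
                 (subst (T ∘ isP) (sym (sourcePositive N e∈)) tt) (subst (T ∘ isM) (sym (sinkNegative N e∈)) tt)))

isNetwork-≡ : ∀ {δ E δ′ E′} → (Network δ E → Network δ′ E′) → (Network δ′ E′ → Network δ E) →
              isNetwork δ E ≡ isNetwork δ′ E′
isNetwork-≡ {δ} {E} {δ′} {E′} to from =
  T⇔T⇒≡ (Network⇒isNetwork δ′ E′ ∘ to ∘ isNetwork⇒Network δ E) (Network⇒isNetwork δ E ∘ from ∘ isNetwork⇒Network δ′ E′)

Network-resp-⊆⊇ : ∀ {δ E E′} → E ⊆ E′ → E′ ⊆ E → Network δ E → Network δ E′
Network-resp-⊆⊇ E⊆E′ E′⊆E N = record
  { closedB1       = λ e∈ e′∈ a<b b<c c<d → E⊆E′ (closedB1 N (E′⊆E e∈) (E′⊆E e′∈) a<b b<c c<d)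
  ; sourcePositive = sourcePositive N ∘ E′⊆E
  ; sinkNegative   = sinkNegative N ∘ E′⊆E
  }

isNetwork-↭ : ∀ δ → PermutationInvariant (isNetwork δ)
isNetwork-↭ δ {S} {S′} σ = isNetwork-≡ {δ} {S} {δ} {S′}
  (Network-resp-⊆⊇ (∈-resp-↭ σ) (∈-resp-↭ (↭-sym σ)))
  (Network-resp-⊆⊇ (∈-resp-↭ (↭-sym σ)) (∈-resp-↭ σ))

#networks : List Sgn → (List Edge → Bool) → ℕ
#networks δ Q = countSubsets (λ S → isNetwork δ S ∧ Q S) (allPairs (length δ))

#networks-cong : ∀ δ {Q Q′ : List Edge → Bool} → (∀ S → Q S ≡ Q′ S) → #networks δ Q ≡ #networks δ Q′
#networks-cong δ Q≗Q′ = count-cong _ _ (subsetsOf (allPairs (length δ))) (λ {S} _ → cong (isNetwork δ S ∧_) (Q≗Q′ S))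

hasSize : ℕ → List Edge → Bool
hasSize r S = length S ≡ᵇ r

hasSize-↭ : ∀ r → PermutationInvariant (hasSize r)
hasSize-↭ r σ = cong (_≡ᵇ r) (↭-length σ)

𝒲≡#networks : ∀ δ r → 𝒲 δ r ≡ #networks δ (hasSize r)
𝒲≡#networks δ r = length-filter-T? (λ S → isNetwork δ S ∧ hasSize r S) (subsetsOf (allPairs (length δ)))

hasSize-++ : ∀ {r} (xs ys : List Edge) → length xs ≤ r → hasSize r (xs ++ ys) ≡ hasSize (r ∸ length xs) ys
hasSize-++ {r} xs ys |xs|≤r = begin
  length (xs ++ ys) ≡ᵇ r
    ≡⟨ cong₂ _≡ᵇ_ (length-++ xs) (sym (m+[n∸m]≡n |xs|≤r)) ⟩
  length xs + length ys ≡ᵇ length xs + (r ∸ length xs)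
    ≡⟨ +-≡ᵇ-cancelˡ (length xs) ⟩
  length ys ≡ᵇ r ∸ length xs ∎
  where open ≡-Reasoning

hasSize-++-≰ : ∀ {r} (xs ys : List Edge) → ¬ length xs ≤ r → hasSize r (xs ++ ys) ≡ false
hasSize-++-≰ {r} xs ys |xs|≰r = ¬T⇒≡false (λ t → |xs|≰r (≤-trans (length-++-≤ˡ xs) (≤-reflexive (≡ᵇ⇒≡ _ r t))))

qPow*-≤ : ∀ {a r} (f : Poly) → a ≤ r → qPow* a f r ≡ f (r ∸ a)
qPow*-≤ {a} {r} f a≤r with a ≤ᵇ r | ≤⇒≤ᵇ a≤r
... | true | _ = refl

qPow*-≰ : ∀ {a r} (f : Poly) → ¬ a ≤ r → qPow* a f r ≡ 0
qPow*-≰ {a} {r} f a≰r with a ≤ᵇ r in a≤ᵇr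
... | true  = ⊥-elim (a≰r (≤ᵇ⇒≤ a r (subst T (sym a≤ᵇr) tt)))
... | false = refl

sumP-apply : (F : A → Poly) (L : List A) (r : ℕ) → sumP (map F L) r ≡ sum (map (λ x → F x r) L)
sumP-apply F []      r = refl
sumP-apply F (x ∷ L) r = cong (F x r +_) (sumP-apply F L r)

-- Relabelling and deleting positions

mapEdge : (ℕ → ℕ) → Edge → Edge
mapEdge f e = f (src e) , f (snk e)

module _ {f : ℕ → ℕ} (f-mono : f Preserves _<_ ⟶ _<_) where

  strictlyMonotone-reflects-< : ∀ {a b} → f a < f b → a < b
  strictlyMonotone-reflects-< {a} {b} fa<fb with <-cmp a b
  ... | tri< a<b _ _ = a<b
  ... | tri≈ _ refl _ = ⊥-elim (<-irrefl refl fa<fb)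
  ... | tri> _ _ b<a = ⊥-elim (<-asym fa<fb (f-mono b<a))

  strictlyMonotone-injective : ∀ {a b} → f a ≡ f b → a ≡ b
  strictlyMonotone-injective {a} {b} fa≡fb with <-cmp a b
  ... | tri< a<b _ _ = ⊥-elim (<-irrefl fa≡fb (f-mono a<b))
  ... | tri≈ _ a≡b _ = a≡b
  ... | tri> _ _ b<a = ⊥-elim (<-irrefl (sym fa≡fb) (f-mono b<a))

  mapEdge-injective : ∀ {e e′} → mapEdge f e ≡ mapEdge f e′ → e ≡ e′
  mapEdge-injective eq =
    cong₂ _,_ (strictlyMonotone-injective (cong src eq)) (strictlyMonotone-injective (cong snk eq))

  module _ {δ δ′ : List Sgn} (at-f : ∀ i → at δ (f i) ≡ at δ′ i) where

    Network-relabel⁻ : ∀ {S} → Network δ (map (mapEdge f) S) → Network δ′ S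
    Network-relabel⁻ {S} N = record
      { closedB1       = closed
      ; sourcePositive = λ {e} e∈ → ≡-trans (sym (at-f (src e))) (sourcePositive N (∈-map⁺ (mapEdge f) e∈))
      ; sinkNegative   = λ {e} e∈ → ≡-trans (sym (at-f (snk e))) (sinkNegative N (∈-map⁺ (mapEdge f) e∈))
      }
      where
      closed : ∀ {e e′} → e ∈ S → e′ ∈ S → src e < src e′ → src e′ < snk e → snk e < snk e′ →
               (src e′ , snk e) ∈ S
      closed e∈ e′∈ a<b b<c c<d
        with ∈-map⁻ (mapEdge f)
               (closedB1 N (∈-map⁺ (mapEdge f) e∈) (∈-map⁺ (mapEdge f) e′∈) (f-mono a<b) (f-mono b<c) (f-mono c<d))
      ... | e″ , e″∈ , eq = subst (_∈ S) (sym (mapEdge-injective eq)) e″∈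

    Network-relabel⁺ : ∀ {S} → Network δ′ S → Network δ (map (mapEdge f) S)
    Network-relabel⁺ {S} N = record
      { closedB1       = closed
      ; sourcePositive = λ e∈ → let e , e∈S , eq = ∈-map⁻ (mapEdge f) e∈ in
                           subst (λ e → at δ (src e) ≡ just p1) (sym eq) (≡-trans (at-f (src e)) (sourcePositive N e∈S))
      ; sinkNegative   = λ e∈ → let e , e∈S , eq = ∈-map⁻ (mapEdge f) e∈ in
                           subst (λ e → at δ (snk e) ≡ just m1) (sym eq) (≡-trans (at-f (snk e)) (sinkNegative N e∈S))
      }
      where
      closed : ∀ {e e′} → e ∈ map (mapEdge f) S → e′ ∈ map (mapEdge f) S →
               src e < src e′ → src e′ < snk e → snk e < snk e′ → (src e′ , snk e) ∈ map (mapEdge f) S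
      closed e∈ e′∈ a<b b<c c<d with ∈-map⁻ (mapEdge f) e∈ | ∈-map⁻ (mapEdge f) e′∈
      ... | e₀ , e₀∈ , refl | e₀′ , e₀′∈ , refl =
        ∈-map⁺ (mapEdge f) (closedB1 N e₀∈ e₀′∈ (strictlyMonotone-reflects-< a<b)
                  (strictlyMonotone-reflects-< b<c) (strictlyMonotone-reflects-< c<d))

    isNetwork-relabel : ∀ S → isNetwork δ (map (mapEdge f) S) ≡ isNetwork δ′ S
    isNetwork-relabel S = isNetwork-≡ (Network-relabel⁻ {S}) (Network-relabel⁺ {S})

punchIn : ℕ → ℕ → ℕ
punchIn zero    i       = suc i
punchIn (suc x) zero    = zero
punchIn (suc x) (suc i) = suc (punchIn x i)

punchOut : ℕ → ℕ → ℕ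
punchOut zero    a       = pred a
punchOut (suc x) zero    = zero
punchOut (suc x) (suc a) = suc (punchOut x a)

punchIn-mono : ∀ x → punchIn x Preserves _<_ ⟶ _<_
punchIn-mono zero    i<j                 = s≤s i<j
punchIn-mono (suc x) {zero}  {suc j} _   = s≤s z≤n
punchIn-mono (suc x) {suc i} {suc j} i<j = s≤s (punchIn-mono x (≤-pred i<j))

punchIn-below : ∀ {x i} → i < x → punchIn x i ≡ i
punchIn-below {suc x} {zero}  _   = refl
punchIn-below {suc x} {suc i} i<x = cong suc (punchIn-below (≤-pred i<x))

punchIn-≢ : ∀ x i → punchIn x i ≢ x
punchIn-≢ (suc x) (suc i) eq = punchIn-≢ x i (suc-injective eq)

≤-punchIn : ∀ x i → i ≤ punchIn x i
≤-punchIn zero    i       = n≤1+n i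
≤-punchIn (suc x) zero    = z≤n
≤-punchIn (suc x) (suc i) = s≤s (≤-punchIn x i)

punchIn-≤ : ∀ x i → punchIn x i ≤ suc i
punchIn-≤ zero    i       = ≤-refl
punchIn-≤ (suc x) zero    = z≤n
punchIn-≤ (suc x) (suc i) = s≤s (punchIn-≤ x i)

punchIn-positive⁻ : ∀ {x a} → 1 ≤ x → 1 ≤ punchIn x a → 1 ≤ a
punchIn-positive⁻ {suc x} {zero}  _ ()
punchIn-positive⁻ {suc x} {suc a} _ _ = s≤s z≤n

punchIn-punchOut : ∀ {x a} → a ≢ x → punchIn x (punchOut x a) ≡ a
punchIn-punchOut {zero}  {zero}  a≢x = ⊥-elim (a≢x refl)
punchIn-punchOut {zero}  {suc a} _   = refl
punchIn-punchOut {suc x} {zero}  _   = refl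
punchIn-punchOut {suc x} {suc a} a≢x = cong suc (punchIn-punchOut (a≢x ∘ cong suc))

punchOut-≤ : ∀ {x a m} → a ≢ x → a ≤ suc m → x ≤ suc m → punchOut x a ≤ m
punchOut-≤ {zero}              _   a≤1+m _         = pred-mono-≤ a≤1+m
punchOut-≤ {suc x} {zero}      _   _     _         = z≤n
punchOut-≤ {suc x} {suc a} {zero}  a≢x (s≤s z≤n) (s≤s z≤n) = ⊥-elim (a≢x refl)
punchOut-≤ {suc x} {suc a} {suc m} a≢x a≤ x≤ = s≤s (punchOut-≤ (a≢x ∘ cong suc) (≤-pred a≤) (≤-pred x≤))

-- Positions are 1-based, as for `at`, so `deleteAt 0` deletes nothing.
deleteAt : ℕ → List A → List A
deleteAt zero          ys       = ys
deleteAt (suc x)       []       = []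
deleteAt (suc zero)    (y ∷ ys) = ys
deleteAt (suc (suc x)) (y ∷ ys) = y ∷ deleteAt (suc x) ys

at-deleteAt : ∀ x (δ : List A) i → at (deleteAt (suc x) δ) i ≡ at δ (punchIn (suc x) i)
at-deleteAt x             δ        zero          = ≡-trans (at-zero (deleteAt (suc x) δ)) (sym (at-zero δ))
at-deleteAt x             []       (suc i)       = refl
at-deleteAt zero          (y ∷ ys) (suc i)       = refl
at-deleteAt (suc x)       (y ∷ ys) (suc zero)    = refl
at-deleteAt (suc x)       (y ∷ ys) (suc (suc i)) = at-deleteAt x ys (suc i)

length-deleteAt : ∀ {x} (δ : List A) → 1 ≤ x → x ≤ length δ → suc (length (deleteAt x δ)) ≡ length δ
length-deleteAt {x = suc zero}    (y ∷ ys) _ _        = refl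
length-deleteAt {x = suc (suc x)} (y ∷ ys) _ (s≤s x≤) = cong suc (length-deleteAt ys (s≤s z≤n) x≤)

avoids : ℕ → Edge → Bool
avoids x e = not (src e ≡ᵇ x) ∧ not (snk e ≡ᵇ x)

avoidsAll : List ℕ → List Edge → Bool
avoidsAll X S = all (λ x → all (avoids x) S) X

T-avoids⁻ : ∀ {x} e → T (avoids x e) → src e ≢ x × snk e ≢ x
T-avoids⁻ {x} e t = let s , k = T-∧⁻ (not (src e ≡ᵇ x)) (not (snk e ≡ᵇ x)) t in T-not-≡ᵇ⇒≢ s , T-not-≡ᵇ⇒≢ k

T-avoids⁺ : ∀ {x} e → src e ≢ x → snk e ≢ x → T (avoids x e)
T-avoids⁺ {x} e s≢x k≢x = T-∧⁺ (not (src e ≡ᵇ x)) (not (snk e ≡ᵇ x)) (≢⇒T-not-≡ᵇ s≢x) (≢⇒T-not-≡ᵇ k≢x)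

Avoids : List ℕ → List Edge → Set
Avoids X R = ∀ {x e} → x ∈ X → e ∈ R → src e ≢ x × snk e ≢ x

T-avoidsAll⁻ : ∀ X R → T (avoidsAll X R) → Avoids X R
T-avoidsAll⁻ X R t {x} {e} x∈ e∈ =
  T-avoids⁻ e (All.lookup (all⁺ (avoids x) R (All.lookup (all⁺ (λ x → all (avoids x) R) X t) x∈)) e∈)

T-avoidsAll⁺ : ∀ X R → Avoids X R → T (avoidsAll X R)
T-avoidsAll⁺ X R av = all⁻ _ (All.tabulate (λ x∈ → all⁻ _ (All.tabulate (λ {e} e∈ → uncurry (T-avoids⁺ e) (av x∈ e∈)))))

avoidsAll-↭ : ∀ X → PermutationInvariant (avoidsAll X)
avoidsAll-↭ []      σ = refl
avoidsAll-↭ (x ∷ X) σ = cong₂ _∧_ (all-↭ (avoids x) σ) (avoidsAll-↭ X σ)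

≡ᵇ-punchIn : ∀ {x y} → y < x → ∀ a → (punchIn x a ≡ᵇ y) ≡ (a ≡ᵇ y)
≡ᵇ-punchIn {x} {y} y<x a = T⇔T⇒≡
  (λ t → ≡⇒≡ᵇ a y (strictlyMonotone-injective (punchIn-mono x) (≡-trans (≡ᵇ⇒≡ _ y t) (sym (punchIn-below y<x)))))
  (λ t → ≡⇒≡ᵇ _ y (≡-trans (cong (punchIn x) (≡ᵇ⇒≡ a y t)) (punchIn-below y<x)))

avoidsAll-punchIn : ∀ {x X} → All (_< x) X → ∀ S → avoidsAll X (map (mapEdge (punchIn x)) S) ≡ avoidsAll X S
avoidsAll-punchIn []           S = refl
avoidsAll-punchIn {x} (y<x ∷ X<x) S = cong₂ _∧_
  (≡-trans (all-map (avoids _) (mapEdge (punchIn x)) S)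
           (cong and (map-cong (λ e → cong₂ _∧_ (cong not (≡ᵇ-punchIn y<x (src e)))
                                                (cong not (≡ᵇ-punchIn y<x (snk e)))) S)))
  (avoidsAll-punchIn X<x S)

all-avoids-punchIn : ∀ x S → T (all (avoids x) (map (mapEdge (punchIn x)) S))
all-avoids-punchIn x S =
  all⁻ (avoids x) (All.map⁺ (All.tabulate {xs = S} (λ {e} _ →
    T-avoids⁺ (mapEdge (punchIn x) e) (punchIn-≢ x (src e)) (punchIn-≢ x (snk e)))))

allPairs-avoiding-↭ : ∀ {x m} → 1 ≤ x → x ≤ suc m →
  filter (T? ∘ avoids x) (allPairs (suc m)) ↭ map (mapEdge (punchIn x)) (allPairs m)
allPairs-avoiding-↭ {x} {m} 1≤x x≤1+m =
  ↭-fromUnique (Unique.filter⁺ (T? ∘ avoids x) (allPairs-Unique (suc m)))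
               (Unique.map⁺ (mapEdge-injective (punchIn-mono x)) (allPairs-Unique m)) kept⊆shifted shifted⊆kept
  where
  kept⊆shifted : filter (T? ∘ avoids x) (allPairs (suc m)) ⊆ map (mapEdge (punchIn x)) (allPairs m)
  kept⊆shifted {a , b} e∈ with ∈-filter⁻ (T? ∘ avoids x) {xs = allPairs (suc m)} e∈
  ... | e∈′ , t with ∈-allPairs⁻ (suc m) e∈′ | T-avoids⁻ (a , b) t
  ... | 1≤a , a<b , b≤ | a≢x , b≢x
    with punchOut x a | punchIn-punchOut a≢x | punchOut x b | punchIn-punchOut b≢x | punchOut-≤ b≢x b≤ x≤1+m
  ... | a′ | refl | b′ | refl | b′≤m = ∈-map⁺ (mapEdge (punchIn x))
          (∈-allPairs⁺ m (punchIn-positive⁻ 1≤x 1≤a) (strictlyMonotone-reflects-< (punchIn-mono x) a<b) b′≤m)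

  shifted⊆kept : map (mapEdge (punchIn x)) (allPairs m) ⊆ filter (T? ∘ avoids x) (allPairs (suc m))
  shifted⊆kept e∈ with ∈-map⁻ (mapEdge (punchIn x)) e∈
  ... | (a , b) , ab∈ , refl with ∈-allPairs⁻ m ab∈
  ... | 1≤a , a<b , b≤m = ∈-filter⁺ (T? ∘ avoids x)
          (∈-allPairs⁺ (suc m) (≤-trans 1≤a (≤-punchIn x a)) (punchIn-mono x a<b) (≤-trans (punchIn-≤ x b) (s≤s b≤m)))
          (T-avoids⁺ (mapEdge (punchIn x) (a , b)) (punchIn-≢ x a) (punchIn-≢ x b))

#networks-deleteAt : ∀ δ {x} → 1 ≤ x → x ≤ length δ → (Q : List Edge → Bool) → PermutationInvariant Q →
  (∀ S → Q (map (mapEdge (punchIn x)) S) ≡ Q S) →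
  #networks δ (λ S → all (avoids x) S ∧ Q S) ≡ #networks (deleteAt x δ) Q
#networks-deleteAt δ {suc x} 1≤x x≤n Q Q-↭ Q-relabel = begin
  countSubsets P (allPairs (length δ))
    ≡⟨ cong (countSubsets P ∘ allPairs) n≡1+m ⟩
  countSubsets P (allPairs (suc m))
    ≡⟨ countSubsets-filter (avoids (suc x)) P (allPairs (suc m)) P-supported ⟩
  countSubsets P (filter (T? ∘ avoids (suc x)) (allPairs (suc m)))
    ≡⟨ countSubsets-↭ P P-↭ (allPairs-avoiding-↭ 1≤x (subst (suc x ≤_) n≡1+m x≤n)) ⟩
  countSubsets P (map shift (allPairs m))
    ≡⟨ countSubsets-map P shift (allPairs m) ⟩
  countSubsets (P ∘ map shift) (allPairs m)
    ≡⟨ count-cong _ _ (subsetsOf (allPairs m)) (λ {S} _ → P-relabel S) ⟩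
  #networks (deleteAt (suc x) δ) Q ∎
  where
  open ≡-Reasoning
  shift = mapEdge (punchIn (suc x))
  m = length (deleteAt (suc x) δ)
  n≡1+m : length δ ≡ suc m
  n≡1+m = sym (length-deleteAt δ 1≤x x≤n)
  P : List Edge → Bool
  P S = isNetwork δ S ∧ (all (avoids (suc x)) S ∧ Q S)
  P-↭ : PermutationInvariant P
  P-↭ σ = cong₂ _∧_ (isNetwork-↭ δ σ) (cong₂ _∧_ (all-↭ (avoids (suc x)) σ) (Q-↭ σ))
  P-supported : ∀ R {e} → e ∈ R → T (P R) → T (avoids (suc x) e)
  P-supported R e∈ t =
    All.lookup (all⁺ _ R (proj₁ (T-∧⁻ (all (avoids (suc x)) R) (Q R) (proj₂ (T-∧⁻ (isNetwork δ R) _ t))))) e∈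
  P-relabel : ∀ S → P (map shift S) ≡ isNetwork (deleteAt (suc x) δ) S ∧ Q S
  P-relabel S = cong₂ _∧_
    (isNetwork-relabel (punchIn-mono (suc x)) {δ} {deleteAt (suc x) δ} (λ i → sym (at-deleteAt x δ i)) S)
    (≡-trans (cong (_∧ Q (map shift S)) (Equivalence.to T-≡ (all-avoids-punchIn (suc x) S))) (Q-relabel S))

deleteAll : List ℕ → List A → List A
deleteAll []      δ = δ
deleteAll (x ∷ X) δ = deleteAll X (deleteAt x δ)

-- Deleting in decreasing order leaves the positions still to be deleted in place.
#networks-deleteAll : ∀ X δ r → AllPairs _>_ X → All (λ x → 1 ≤ x × x ≤ length δ) X →
  #networks δ (λ S → avoidsAll X S ∧ hasSize r S) ≡ #networks (deleteAll X δ) (hasSize r)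
#networks-deleteAll []      δ r _              _                           = refl
#networks-deleteAll (x ∷ X) δ r (x>X ∷ X-desc) ((1≤x , x≤n) ∷ X-bounds) = begin
  #networks δ (λ S → (all (avoids x) S ∧ avoidsAll X S) ∧ hasSize r S)
    ≡⟨ #networks-cong δ (λ S → ∧-assoc (all (avoids x) S) _ _) ⟩
  #networks δ (λ S → all (avoids x) S ∧ Q S)
    ≡⟨ #networks-deleteAt δ 1≤x x≤n Q Q-↭ Q-relabel ⟩
  #networks (deleteAt x δ) Q
    ≡⟨ #networks-deleteAll X (deleteAt x δ) r X-desc (All.zipWith bounds (x>X , X-bounds)) ⟩
  #networks (deleteAll X (deleteAt x δ)) (hasSize r) ∎
  where
  open ≡-Reasoning
  Q : List Edge → Bool
  Q S = avoidsAll X S ∧ hasSize r S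
  Q-↭ : PermutationInvariant Q
  Q-↭ σ = cong₂ _∧_ (avoidsAll-↭ X σ) (hasSize-↭ r σ)
  Q-relabel : ∀ S → Q (map (mapEdge (punchIn x)) S) ≡ Q S
  Q-relabel S = cong₂ _∧_ (avoidsAll-punchIn x>X S) (cong (_≡ᵇ r) (length-map _ S))
  bounds : ∀ {y} → y < x × (1 ≤ y × y ≤ length δ) → 1 ≤ y × y ≤ length (deleteAt x δ)
  bounds (y<x , 1≤y , _) = 1≤y , ≤-pred (≤-trans y<x (≤-trans x≤n (≤-reflexive (sym (length-deleteAt δ 1≤x x≤n)))))

block-shape : ∀ (δ : List A) {s t} ℓ → (∀ i → 1 ≤ i → i ≤ ℓ → at δ i ≡ just s) → at δ (suc ℓ) ≡ just t →
              δ ≡ replicate ℓ s ++ t ∷ drop (suc ℓ) δ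
block-shape (y ∷ ys) zero    _     refl = refl
block-shape (y ∷ ys) (suc ℓ) block last with block 1 (s≤s z≤n) (s≤s z≤n)
... | refl = cong (y ∷_) (block-shape ys ℓ block′ last)
  where
  block′ : ∀ i → 1 ≤ i → i ≤ ℓ → at ys i ≡ just y
  block′ (suc i) _ i<ℓ = block (suc (suc i)) (s≤s z≤n) (s≤s i<ℓ)

deleteAt-after-block : ∀ a (s t : A) rest → deleteAt (suc a) (replicate a s ++ t ∷ rest) ≡ replicate a s ++ rest
deleteAt-after-block zero    s t rest = refl
deleteAt-after-block (suc a) s t rest = cong (s ∷_) (deleteAt-after-block a s t rest)

deleteAt-block : ∀ {y a} (s : A) rest → 1 ≤ y → y ≤ a → deleteAt y (replicate a s ++ rest) ≡ replicate (a ∸ 1) s ++ rest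
deleteAt-block {y = suc zero}    {suc a}       s rest _ _         = refl
deleteAt-block {y = suc (suc y)} {suc (suc a)} s rest _ (s≤s y<a) = cong (s ∷_) (deleteAt-block s rest (s≤s z≤n) y<a)

deleteAll-block : ∀ Y {a} (s : A) rest → AllPairs _>_ Y → All (λ y → 1 ≤ y × y ≤ a) Y →
                  deleteAll Y (replicate a s ++ rest) ≡ replicate (a ∸ length Y) s ++ rest
deleteAll-block []      s rest _              _                        = refl
deleteAll-block (y ∷ Y) {a} s rest (y>Y ∷ Y-desc) ((1≤y , y≤a) ∷ Y-bounds) = begin
  deleteAll Y (deleteAt y (replicate a s ++ rest))
    ≡⟨ cong (deleteAll Y) (deleteAt-block s rest 1≤y y≤a) ⟩
  deleteAll Y (replicate (a ∸ 1) s ++ rest)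
    ≡⟨ deleteAll-block Y s rest Y-desc (All.zipWith bounds (y>Y , Y-bounds)) ⟩
  replicate (a ∸ 1 ∸ length Y) s ++ rest
    ≡⟨ cong (λ k → replicate k s ++ rest) (∸-+-assoc a 1 (length Y)) ⟩
  replicate (a ∸ suc (length Y)) s ++ rest ∎
  where
  open ≡-Reasoning
  bounds : ∀ {z} → z < y × (1 ≤ z × z ≤ a) → 1 ≤ z × z ≤ a ∸ 1
  bounds (z<y , 1≤z , _) = 1≤z , ∸-monoˡ-≤ 1 (≤-trans z<y y≤a)

AllPairs-reverse : ∀ {R : A → A → Set} {xs} → AllPairs R xs → AllPairs (flip R) (reverse xs)
AllPairs-reverse []                             = []
AllPairs-reverse {xs = x ∷ xs} (x-R-xs ∷ xs-R) rewrite unfold-reverse x xs =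
  AllPairs.++⁺ (AllPairs-reverse xs-R) ([] ∷ []) (All.tabulate (λ y∈ → All.lookup x-R-xs (Any.reverse⁻ y∈) ∷ []))

T-memℕ⁻ : ∀ {k} K → T (memℕ k K) → k ∈ K
T-memℕ⁻ {k} K t = Any.map (≡ᵇ⇒≡ k _) (any⁻ (k ≡ᵇ_) K t)

T-memℕ⁺ : ∀ {k K} → k ∈ K → T (memℕ k K)
T-memℕ⁺ {k} k∈ = any⁺ (k ≡ᵇ_) (Any.map (λ { refl → ≡⇒≡ᵇ k k refl }) k∈)

foldr-⊓-∈ : ∀ t ts → foldr _⊓_ t ts ∈ t ∷ ts
foldr-⊓-∈ t ts with foldr-selective ⊓-sel t ts
... | inj₁ eq = here eq
... | inj₂ m∈ = there m∈

foldr-⊓-≤ : ∀ t ts → All (foldr _⊓_ t ts ≤_) (t ∷ ts)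
foldr-⊓-≤ t []       = ≤-refl ∷ []
foldr-⊓-≤ t (z ∷ ts) with foldr-⊓-≤ t ts
... | m≤t ∷ m≤ts = ≤-trans (m⊓n≤n z _) m≤t ∷ m⊓n≤m z _ ∷ All.map (≤-trans (m⊓n≤n z _)) m≤ts

isGap : ℕ → List ℕ → ℕ → Bool
isGap t ts k = not (memℕ k (t ∷ ts)) ∧ (foldr _⊓_ t ts <ᵇ k)

gaps : ℕ → List ℕ → List ℕ
gaps j []       = []
gaps j (t ∷ ts) = filter (T? ∘ isGap t ts) (range1 (j ∸ 1))

dT≡length-gaps : ∀ j I → dT j I ≡ length (gaps j I)
dT≡length-gaps j []      = refl
dT≡length-gaps j (t ∷ ts) = refl

gaps-increasing : ∀ j I → AllPairs _<_ (gaps j I)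
gaps-increasing j []       = []
gaps-increasing j (t ∷ ts) =
  AllPairs.filter⁺ _ (AllPairs.map⁺ (AllPairs.applyUpTo⁺₁ (λ i → i) (j ∸ 1) (λ i<k _ → s≤s i<k)))

∈-gaps⁻ : ∀ j t ts {k} → k ∈ gaps j (t ∷ ts) → (1 ≤ k × k ≤ j ∸ 1) × k ∉ t ∷ ts × foldr _⊓_ t ts < k
∈-gaps⁻ j t ts {k} k∈ with ∈-filter⁻ (T? ∘ isGap t ts) {xs = range1 (j ∸ 1)} k∈
... | k∈range , tk = let k∉ , min<k = T-∧⁻ (not (memℕ k (t ∷ ts))) (foldr _⊓_ t ts <ᵇ k) tk in
  ∈-range1⁻ k∈range , T-not⁻ k∉ ∘ T-memℕ⁺ , <ᵇ⇒< _ _ min<k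

∈-gaps⁺ : ∀ j t ts {k} → 1 ≤ k → k ≤ j ∸ 1 → k ∉ t ∷ ts → foldr _⊓_ t ts < k → k ∈ gaps j (t ∷ ts)
∈-gaps⁺ j t ts {k} 1≤k k≤ k∉ min<k =
  ∈-filter⁺ (T? ∘ isGap t ts) (∈-range1⁺ 1≤k k≤)
    (T-∧⁺ (not (memℕ k (t ∷ ts))) (foldr _⊓_ t ts <ᵇ k) (T-not⁺ (k∉ ∘ T-memℕ⁻ (t ∷ ts))) (<⇒<ᵇ min<k))

gaps-bounded : ∀ j I → All (λ k → 1 ≤ k × k ≤ j ∸ 1) (gaps j I)
gaps-bounded j []       = []
gaps-bounded j (t ∷ ts) = All.tabulate (proj₁ ∘ ∈-gaps⁻ j t ts)

-- Splitting off the edges into j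

fanIn : ℕ → List ℕ → List Edge
fanIn j I = map (_, j) I

∈-fanIn⁻ : ∀ {j I e} → e ∈ fanIn j I → src e ∈ I × snk e ≡ j
∈-fanIn⁻ e∈ with ∈-map⁻ _ e∈
... | t , t∈ , refl = t∈ , refl

notInto : ℕ → Edge → Bool
notInto j e = not (snk e ≡ᵇ j)

allPairs-↭-fanIn : ∀ {ℓ n} → suc ℓ ≤ n →
  allPairs n ↭ fanIn (suc ℓ) (range1 ℓ) ++ filter (T? ∘ notInto (suc ℓ)) (allPairs n)
allPairs-↭-fanIn {ℓ} {n} j≤n =
  ↭-fromUnique (allPairs-Unique n)
    (Unique.++⁺ (Unique.map⁺ (cong src) (range1-Unique ℓ))
                (Unique.filter⁺ (T? ∘ notInto (suc ℓ)) (allPairs-Unique n)) disjoint)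
    split unsplit
  where
  disjoint : Disjoint (fanIn (suc ℓ) (range1 ℓ)) (filter (T? ∘ notInto (suc ℓ)) (allPairs n))
  disjoint (in-fan , in-rest) =
    T-not-≡ᵇ⇒≢ (proj₂ (∈-filter⁻ (T? ∘ notInto (suc ℓ)) {xs = allPairs n} in-rest)) (proj₂ (∈-fanIn⁻ in-fan))
  split : allPairs n ⊆ fanIn (suc ℓ) (range1 ℓ) ++ filter (T? ∘ notInto (suc ℓ)) (allPairs n)
  split {a , b} e∈ with b ≟ suc ℓ | ∈-allPairs⁻ n e∈
  ... | yes refl | 1≤a , a<b , _ = ∈-++⁺ˡ (∈-map⁺ (_, suc ℓ) (∈-range1⁺ 1≤a (≤-pred a<b)))
  ... | no  b≢j  | _             = ∈-++⁺ʳ _ (∈-filter⁺ (T? ∘ notInto (suc ℓ)) e∈ (≢⇒T-not-≡ᵇ b≢j))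
  unsplit : fanIn (suc ℓ) (range1 ℓ) ++ filter (T? ∘ notInto (suc ℓ)) (allPairs n) ⊆ allPairs n
  unsplit e∈ with ∈-++⁻ (fanIn (suc ℓ) (range1 ℓ)) e∈
  ... | inj₂ in-rest = proj₁ (∈-filter⁻ (T? ∘ notInto (suc ℓ)) in-rest)
  ... | inj₁ in-fan with ∈-map⁻ (_, suc ℓ) in-fan
  ...   | t , t∈ , refl = let 1≤t , t≤ℓ = ∈-range1⁻ t∈ in ∈-allPairs⁺ n 1≤t (s≤s t≤ℓ) j≤n

module Splitting (ε : List Sgn) (ℓ : ℕ)
                 (ε-block : ∀ i → 1 ≤ i → i ≤ ℓ → at ε i ≡ just p1) (ε-sink : at ε (suc ℓ) ≡ just m1) where

  j : ℕ
  j = suc ℓ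

  forbidden : List ℕ → List ℕ
  forbidden I = j ∷ reverse (gaps j I)

  NoEdgeInto-j : List Edge → Set
  NoEdgeInto-j R = ∀ {e} → e ∈ R → snk e ≢ j

  after-block : ∀ {v} → at ε v ≡ just m1 → ℓ < v
  after-block v- = ≰⇒> (λ v≤ℓ → signs-distinct ε (ε-block _ (at-positive ε v-) v≤ℓ) v- refl)

  gaps-avoided : ∀ I {R} → NoEdgeInto-j R → Network ε (fanIn j I ++ R) →
                 ∀ {k e} → k ∈ gaps j I → e ∈ R → src e ≢ k × snk e ≢ k
  gaps-avoided []       _      _ ()
  gaps-avoided (t ∷ ts) {R} into-j N {k} {e} k∈ e∈ with ∈-gaps⁻ j t ts k∈
  ... | (_ , k≤ℓ) , k∉I , min<k = src≢k , snk≢k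
    where
    e∈′ = ∈-++⁺ʳ (fanIn j (t ∷ ts)) e∈
    ℓ<snk = after-block (sinkNegative N e∈′)
    snk≢k : snk e ≢ k
    snk≢k eq = <⇒≢ (≤-<-trans k≤ℓ ℓ<snk) (sym eq)
    -- (B1) applied to the edges (min I, j) and e forces (src e, j) into the network.
    src≢k : src e ≢ k
    src≢k eq with ∈-++⁻ (fanIn j (t ∷ ts))
      (closedB1 N (∈-++⁺ˡ (∈-map⁺ (_, j) (foldr-⊓-∈ t ts))) e∈′
         (subst (_ <_) (sym eq) min<k) (subst (_< j) (sym eq) (s≤s k≤ℓ)) (≤∧≢⇒< ℓ<snk (≢-sym (into-j e∈))))
    ... | inj₁ in-fan = k∉I (subst (_∈ t ∷ ts) eq (proj₁ (∈-fanIn⁻ in-fan)))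
    ... | inj₂ in-R   = into-j in-R refl

  Network-fanIn-++⁻ : ∀ I {R} → NoEdgeInto-j R → Network ε (fanIn j I ++ R) →
                      Network ε R × Avoids (forbidden I) R
  Network-fanIn-++⁻ I {R} into-j N = N-R , R-avoids
    where
    inR : R ⊆ fanIn j I ++ R
    inR = ∈-++⁺ʳ (fanIn j I)
    closed : ∀ {e e′} → e ∈ R → e′ ∈ R → src e < src e′ → src e′ < snk e → snk e < snk e′ → (src e′ , snk e) ∈ R
    closed e∈ e′∈ a<b b<c c<d with ∈-++⁻ (fanIn j I) (closedB1 N (inR e∈) (inR e′∈) a<b b<c c<d)
    ... | inj₁ in-fan = ⊥-elim (into-j e∈ (proj₂ (∈-fanIn⁻ in-fan)))
    ... | inj₂ in-R   = in-R
    N-R : Network ε R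
    N-R = record { closedB1 = closed ; sourcePositive = sourcePositive N ∘ inR ; sinkNegative = sinkNegative N ∘ inR }
    R-avoids : Avoids (forbidden I) R
    R-avoids (here refl) e∈ = (λ eq → signs-distinct ε (sourcePositive N (inR e∈)) ε-sink eq) , into-j e∈
    R-avoids (there k∈) e∈ = gaps-avoided I into-j N (Any.reverse⁻ k∈) e∈

  fanIn-source-closed : ∀ I {R} → Avoids (forbidden I) R →
                        ∀ {t e} → t ∈ I → e ∈ R → t < src e → src e < j → src e ∈ I
  fanIn-source-closed []        _        ()
  fanIn-source-closed (t′ ∷ ts) R-avoids {t} {e} t∈ e∈ t<c c<j with src e ∈? t′ ∷ ts
  ... | yes c∈I = c∈I
  ... | no  c∉I = ⊥-elim (proj₁ (R-avoids (there (Any.reverse⁺ c∈gaps)) e∈) refl)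
    where
    c∈gaps : src e ∈ gaps j (t′ ∷ ts)
    c∈gaps = ∈-gaps⁺ j t′ ts (≤-trans (s≤s z≤n) t<c) (≤-pred c<j) c∉I
               (≤-<-trans (All.lookup (foldr-⊓-≤ t′ ts) t∈) t<c)

  Network-fanIn-++⁺ : ∀ {I R} → I ⊆ range1 ℓ → Network ε R → Avoids (forbidden I) R → Network ε (fanIn j I ++ R)
  Network-fanIn-++⁺ {I} {R} I⊆ N R-avoids =
    record { closedB1 = closed ; sourcePositive = positive ; sinkNegative = negative }
    where
    positive : ∀ {e} → e ∈ fanIn j I ++ R → at ε (src e) ≡ just p1
    positive e∈ with ∈-++⁻ (fanIn j I) e∈
    ... | inj₁ in-fan = uncurry (ε-block _) (∈-range1⁻ (I⊆ (proj₁ (∈-fanIn⁻ in-fan))))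
    ... | inj₂ in-R   = sourcePositive N in-R
    negative : ∀ {e} → e ∈ fanIn j I ++ R → at ε (snk e) ≡ just m1
    negative e∈ with ∈-++⁻ (fanIn j I) e∈
    ... | inj₁ in-fan = subst (λ v → at ε v ≡ just m1) (sym (proj₂ (∈-fanIn⁻ in-fan))) ε-sink
    ... | inj₂ in-R   = sinkNegative N in-R
    closed : ∀ {e e′} → e ∈ fanIn j I ++ R → e′ ∈ fanIn j I ++ R →
             src e < src e′ → src e′ < snk e → snk e < snk e′ → (src e′ , snk e) ∈ fanIn j I ++ R
    closed {e} {e′} e∈ e′∈ a<b b<c c<d with ∈-++⁻ (fanIn j I) e′∈
    ... | inj₁ e′-fan = ⊥-elim (<-irrefl refl
            (<-≤-trans (after-block (negative e∈)) (≤-pred (subst (snk e <_) (proj₂ (∈-fanIn⁻ e′-fan)) c<d))))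
    ... | inj₂ e′-R with ∈-++⁻ (fanIn j I) e∈
    ...   | inj₂ e-R   = ∈-++⁺ʳ (fanIn j I) (closedB1 N e-R e′-R a<b b<c c<d)
    ...   | inj₁ e-fan with ∈-fanIn⁻ e-fan
    ...     | t∈ , refl = ∈-++⁺ˡ (∈-map⁺ (_, j) (fanIn-source-closed I R-avoids t∈ e′-R a<b b<c))

  isNetwork-fanIn-++ : ∀ {I R} → I ⊆ range1 ℓ → NoEdgeInto-j R →
                       isNetwork ε (fanIn j I ++ R) ≡ isNetwork ε R ∧ avoidsAll (forbidden I) R
  isNetwork-fanIn-++ {I} {R} I⊆ into-j = T⇔T⇒≡
    (λ t → let N , R-avoids = Network-fanIn-++⁻ I into-j (isNetwork⇒Network ε _ t) in
           T-∧⁺ (isNetwork ε R) (avoidsAll (forbidden I) R) (Network⇒isNetwork ε R N) (T-avoidsAll⁺ _ R R-avoids))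
    (λ t → let tN , tR-avoids = T-∧⁻ (isNetwork ε R) (avoidsAll (forbidden I) R) t in
           Network⇒isNetwork ε _ (Network-fanIn-++⁺ I⊆ (isNetwork⇒Network ε R tN) (T-avoidsAll⁻ _ R tR-avoids)))

  forbidden-decreasing : ∀ I → AllPairs _>_ (forbidden I)
  forbidden-decreasing I =
    All.tabulate (λ k∈ → s≤s (proj₂ (All.lookup (gaps-bounded j I) (Any.reverse⁻ k∈))))
    ∷ AllPairs-reverse (gaps-increasing j I)

  forbidden-bounded : ∀ I → All (λ x → 1 ≤ x × x ≤ length ε) (forbidden I)
  forbidden-bounded I =
    (s≤s z≤n , j≤n) ∷ All.tabulate (λ k∈ → bounded (All.lookup (gaps-bounded j I) (Any.reverse⁻ k∈)))
    where
    j≤n = at-length ε ε-sink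
    bounded : ∀ {k} → 1 ≤ k × k ≤ ℓ → 1 ≤ k × k ≤ length ε
    bounded (1≤k , k≤ℓ) = 1≤k , ≤-trans k≤ℓ (≤-trans (n≤1+n ℓ) j≤n)

  deleteAll-forbidden : ∀ I → deleteAll (forbidden I) ε ≡ εT ε j I
  deleteAll-forbidden I = begin
    deleteAll (reverse G) (deleteAt j ε)
      ≡⟨ cong (deleteAll (reverse G) ∘ deleteAt j) (block-shape ε ℓ ε-block ε-sink) ⟩
    deleteAll (reverse G) (deleteAt j (replicate ℓ p1 ++ m1 ∷ ε′))
      ≡⟨ cong (deleteAll (reverse G)) (deleteAt-after-block ℓ p1 m1 ε′) ⟩
    deleteAll (reverse G) (replicate ℓ p1 ++ ε′)
      ≡⟨ deleteAll-block (reverse G) p1 ε′ (AllPairs-reverse (gaps-increasing j I))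
           (All.tabulate (All.lookup (gaps-bounded j I) ∘ Any.reverse⁻)) ⟩
    replicate (ℓ ∸ length (reverse G)) p1 ++ ε′
      ≡⟨ cong (λ d → replicate (ℓ ∸ d) p1 ++ ε′) (≡-trans (length-reverse G) (sym (dT≡length-gaps j I))) ⟩
    εT ε j I ∎
    where
    open ≡-Reasoning
    G = gaps j I
    ε′ = drop j ε

  #networks-avoiding-forbidden : ∀ I r → #networks ε (λ R → avoidsAll (forbidden I) R ∧ hasSize r R) ≡ 𝒲 (εT ε j I) r
  #networks-avoiding-forbidden I r = begin
    #networks ε (λ R → avoidsAll (forbidden I) R ∧ hasSize r R)
      ≡⟨ #networks-deleteAll (forbidden I) ε r (forbidden-decreasing I) (forbidden-bounded I) ⟩
    #networks (deleteAll (forbidden I) ε) (hasSize r)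
      ≡⟨ cong (λ δ → #networks δ (hasSize r)) (deleteAll-forbidden I) ⟩
    #networks (εT ε j I) (hasSize r)
      ≡⟨ 𝒲≡#networks (εT ε j I) r ⟨
    𝒲 (εT ε j I) r ∎
    where open ≡-Reasoning

  isNetwork∧hasSize-fanIn-++ : ∀ {I R r} → I ⊆ range1 ℓ → NoEdgeInto-j R → length I ≤ r →
    isNetwork ε (fanIn j I ++ R) ∧ hasSize r (fanIn j I ++ R)
    ≡ isNetwork ε R ∧ (avoidsAll (forbidden I) R ∧ hasSize (r ∸ length I) R)
  isNetwork∧hasSize-fanIn-++ {I} {R} {r} I⊆ into-j |I|≤r = begin
    isNetwork ε (fanIn j I ++ R) ∧ hasSize r (fanIn j I ++ R)
      ≡⟨ cong₂ _∧_ (isNetwork-fanIn-++ I⊆ into-j) (hasSize-++ (fanIn j I) R (subst (_≤ r) (sym |fanIn|) |I|≤r)) ⟩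
    (isNetwork ε R ∧ avoidsAll (forbidden I) R) ∧ hasSize (r ∸ length (fanIn j I)) R
      ≡⟨ ∧-assoc (isNetwork ε R) _ _ ⟩
    isNetwork ε R ∧ (avoidsAll (forbidden I) R ∧ hasSize (r ∸ length (fanIn j I)) R)
      ≡⟨ cong (λ k → isNetwork ε R ∧ (avoidsAll (forbidden I) R ∧ hasSize (r ∸ k) R)) |fanIn| ⟩
    isNetwork ε R ∧ (avoidsAll (forbidden I) R ∧ hasSize (r ∸ length I) R) ∎
    where
    open ≡-Reasoning
    |fanIn| = length-map (_, j) I

  rest : List Edge
  rest = filter (T? ∘ notInto j) (allPairs (length ε))

  countSubsets-fanIn : ∀ {I} → I ⊆ range1 ℓ → ∀ r →
    countSubsets (λ R → isNetwork ε (fanIn j I ++ R) ∧ hasSize r (fanIn j I ++ R)) rest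
    ≡ qPow* (length I) (𝒲 (εT ε j I)) r
  countSubsets-fanIn {I} I⊆ r with length I ≤? r
  ... | no |I|≰r = ≡-trans (count-none _ (subsetsOf rest) too-large) (sym (qPow*-≰ _ |I|≰r))
    where
    too-large : ∀ {R} → R ∈ subsetsOf rest → isNetwork ε (fanIn j I ++ R) ∧ hasSize r (fanIn j I ++ R) ≡ false
    too-large {R} _ = ≡-trans (cong (isNetwork ε (fanIn j I ++ R) ∧_)
                                    (hasSize-++-≰ (fanIn j I) R (|I|≰r ∘ subst (_≤ r) (length-map _ I))))
                              (∧-zeroʳ _)
  ... | yes |I|≤r = begin
    countSubsets (λ R → isNetwork ε (fanIn j I ++ R) ∧ hasSize r (fanIn j I ++ R)) rest
      ≡⟨ count-cong _ _ (subsetsOf rest) (λ R∈ → isNetwork∧hasSize-fanIn-++ I⊆ (into-j (subsetsOf-⊆ rest R∈)) |I|≤r) ⟩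
    countSubsets P rest
      ≡⟨ countSubsets-filter (notInto j) P (allPairs (length ε)) P-supported ⟨
    #networks ε (λ R → avoidsAll (forbidden I) R ∧ hasSize r′ R)
      ≡⟨ #networks-avoiding-forbidden I r′ ⟩
    𝒲 (εT ε j I) r′
      ≡⟨ qPow*-≤ _ |I|≤r ⟨
    qPow* (length I) (𝒲 (εT ε j I)) r ∎
    where
    open ≡-Reasoning
    r′ = r ∸ length I
    P : List Edge → Bool
    P R = isNetwork ε R ∧ (avoidsAll (forbidden I) R ∧ hasSize r′ R)
    into-j : ∀ {R} → R ⊆ rest → NoEdgeInto-j R
    into-j R⊆ e∈ = T-not-≡ᵇ⇒≢ (proj₂ (∈-filter⁻ (T? ∘ notInto j) {xs = allPairs (length ε)} (R⊆ e∈)))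
    P-supported : ∀ R {e} → e ∈ R → T (P R) → T (notInto j e)
    P-supported R e∈ t = ≢⇒T-not-≡ᵇ (proj₂ (T-avoidsAll⁻ (forbidden I) R
      (proj₁ (T-∧⁻ (avoidsAll (forbidden I) R) (hasSize r′ R) (proj₂ (T-∧⁻ (isNetwork ε R) _ t)))) (here refl) e∈))

-- The hypotheses on the first and last entries of ε are not needed.
proposition4p8 : (ε : List Sgn) (j : ℕ) →
    head ε ≡ just p1 → last ε ≡ just m1 →
    1 ≤ j → at ε j ≡ just m1 → (∀ i → 1 ≤ i → i < j → at ε i ≡ just p1) →
    ∀ r → 𝒲 ε r ≡ sumP (map (λ T → qPow* (length T) (𝒲 (εT ε j T))) (subsetsOf (range1 (j Data.Nat.∸ 1)))) r
proposition4p8 ε (suc ℓ) _ _ _ ε-sink ε-block r = begin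
  𝒲 ε r
    ≡⟨ 𝒲≡#networks ε r ⟩
  countSubsets P (allPairs (length ε))
    ≡⟨ countSubsets-↭ P P-↭ (allPairs-↭-fanIn (at-length ε ε-sink)) ⟩
  countSubsets P (fanIn j (range1 ℓ) ++ rest)
    ≡⟨ countSubsets-++ P (fanIn j (range1 ℓ)) rest ⟩
  sum (map (λ S → countSubsets (P ∘ (S ++_)) rest) (subsetsOf (fanIn j (range1 ℓ))))
    ≡⟨ cong sum (≡-trans (cong (map _) (subsetsOf-map (_, j) (range1 ℓ))) (sym (map-∘ (subsetsOf (range1 ℓ))))) ⟩
  sum (map (λ I → countSubsets (P ∘ (fanIn j I ++_)) rest) (subsetsOf (range1 ℓ)))
    ≡⟨ cong sum (map-cong-local (All.tabulate (λ I∈ → countSubsets-fanIn (subsetsOf-⊆ _ I∈) r))) ⟩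
  sum (map (λ I → qPow* (length I) (𝒲 (εT ε j I)) r) (subsetsOf (range1 ℓ)))
    ≡⟨ sumP-apply _ (subsetsOf (range1 ℓ)) r ⟨
  sumP (map (λ I → qPow* (length I) (𝒲 (εT ε j I))) (subsetsOf (range1 ℓ))) r ∎
  where
  open ≡-Reasoning
  open Splitting ε ℓ (λ i 1≤i i≤ℓ → ε-block i 1≤i (s≤s i≤ℓ)) ε-sink
  P : List Edge → Bool
  P S = isNetwork ε S ∧ hasSize r S
  P-↭ : PermutationInvariant P
  P-↭ σ = cong₂ _∧_ (isNetwork-↭ ε σ) (hasSize-↭ r σ)
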